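{- Let $(G,w)$ be a weighted trigraph and let $R_1,R_2\subseteq V(G)$ be disjoint. Set $\alpha_{R_1}=\alpha(\mathrm{Red}[G,w;R_1])+\mathrm{Ext}[G,w;R_1]$ and $\alpha_{R_1\cup R_2}=\alpha(\mathrm{Red}[G,w;R_1\cup R_2])+\mathrm{Ext}[G,w;R_1\cup R_2]$. Then $\alpha_{R_1}\le\alpha_{R_1\cup R_2}\le\alpha_{R_1}+\sum_{u\in R_2}w(u)$.
   Context: A trigraph $G$ consists of a finite set $V(G)$ and a function $\theta_G:\binom{V(G)}{2}\to\{ -1,0,1\}$; for distinct vertices $u,v$ write $uv$ for $\{u,v\}$; it is semi-adjacent if $\theta_G(uv)=0$, and $u,v$ are anti-adjacent if $\theta_G(uv)\le 0$. A stable set is a set of pairwise anti-adjacent vertices. $G[R]$ is the trigraph on $R$ with $\theta_G$ restricted. Let $D(G)=V(G)\cup\{(u,v): u,v\in V(G),u\neq v\}\cup\binom{V(G)}{2}$. A weight function for $G$ is a map $w:D(G)\to\mathbb{N}$ such that for all distinct $u,v$: if $uv$ is not semi-adjacent then $w(u,v)=w(v,u)=w(uv)=0$, and $w(u,v)\le w(uv)$. A weighted trigraph is a pair $(G,w)$. For $S\subseteq V(G)$, $\mathrm{wt}_{(G,w)}(S)=\sum_{u\in S}w(u)+\sum_{u\in S}\sum_{v\in V(G)\setminus S}w(u,v)+\sum_{uv\in\binom{V(G)\setminus S}{2}}w(uv)$, and $\alpha(G,w)=\max\{\mathrm{wt}_{(G,w)}(S): S\text{ stable in }G\}$. For $R\subseteq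 V(G)$, $\mathrm{Red}[G,w;R]$ is the weighted trigraph $(G[R],w')$ where $w'(u)=\max\{w(u)-\sum_{v\in V(G)\setminus R}(w(uv)-w(u,v)),0\}$ for $u\in R$, and $w'(u,v)=w(u,v)$, $w'(uv)=w(uv)$ for distinct $u,v\in R$; and $\mathrm{Ext}[G,w;R]=\sum_{uv\in\binom{V(G)\setminus R}{2}}w(uv)+\sum_{u\in R}\sum_{v\in V(G)\setminus R}w(uv)$. -}

module Defs where

open import Data.Nat using (ℕ; zero; suc; _+_; _∸_; _⊔_; _≤_; _<ᵇ_)
open import Data.Bool using (Bool; true; false; _∧_; _∨_; not; if_then_else_)
open import Data.Fin using (Fin; zero; suc; toℕ)
open import Data.Fin.Properties using (_≟_)
open import Data.Vec using (Vec; []; _∷_; lookup)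
open import Data.List using (List; []; _∷_; map; _++_; foldr)
open import Data.Product using (_×_)
open import Relation.Nullary using (¬_)
open import Relation.Nullary.Decidable using (⌊_⌋)
open import Relation.Binary.PropositionalEquality using (_≡_; _≢_)

-- Vertex set of G is Fin n.  Subsets of V(G) are Data.Fin.Subset-style Vec Bool n.
Subset : ℕ → Set
Subset n = Vec Bool n

-- value of θ : 1 = adjacent, 0 = semi-adjacent, -1 = strongly anti-adjacent
data Adj : Set where
  plus zero minus : Adj

isPlus : Adj → Bool
isPlus plus = true
isPlus zero = false
isPlus minus = false

-- A trigraph on vertex set Fin n: θ is defined on unordered pairs, i.e. symmetric
-- (its value on the diagonal is irrelevant).
record Trigraph (n : ℕ) : Set where
  field
    θ    : Fin n → Fin n → Adj
    θsym : ∀ u v → θ u v ≡ θ v u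
open Trigraph public

-- A weight function: wv u = w(u), wo u v = w(u,v) (ordered pair),
-- wu u v = w(uv) (unordered pair, hence symmetric). Diagonal values irrelevant.
record Weight {n : ℕ} (G : Trigraph n) : Set where
  field
    wv   : Fin n → ℕ
    wo   : Fin n → Fin n → ℕ
    wu   : Fin n → Fin n → ℕ
    wusym : ∀ u v → wu u v ≡ wu v u
    nonsemi : ∀ u v → u ≢ v → θ G u v ≢ zero → (wo u v ≡ 0) × (wu u v ≡ 0)
    wo≤wu : ∀ u v → u ≢ v → wo u v ≤ wu u v
open Weight public

sumF : ∀ {n} → (Fin n → ℕ) → ℕ
sumF {zero} f = 0
sumF {suc n} f = f zero + sumF (λ i → f (suc i))

sumIn : ∀ {n} → Subset n → (Fin n → ℕ) → ℕ
sumIn S f = sumF (λ u → if lookup S u then f u else 0)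

sumPairsIn : ∀ {n} → Subset n → (Fin n → Fin n → ℕ) → ℕ
sumPairsIn S f = sumIn S (λ u → sumIn S (λ v → if toℕ u <ᵇ toℕ v then f u v else 0))

_∖_ : ∀ {n} → Subset n → Subset n → Subset n
[] ∖ [] = []
(a ∷ A) ∖ (b ∷ B) = (a ∧ not b) ∷ (A ∖ B)

_∪_ : ∀ {n} → Subset n → Subset n → Subset n
[] ∪ [] = []
(a ∷ A) ∪ (b ∷ B) = (a ∨ b) ∷ (A ∪ B)

full : ∀ {n} → Subset n
full {zero} = []
full {suc n} = true ∷ full

allSubsets : ∀ n → List (Subset n)
allSubsets zero = [] ∷ []
allSubsets (suc n) = map (true ∷_) (allSubsets n) ++ map (false ∷_) (allSubsets n)

allF : ∀ {n} → (Fin n → Bool) → Bool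
allF {zero} p = true
allF {suc n} p = p zero ∧ allF (λ i → p (suc i))

-- A weighted trigraph whose vertex set is V ⊆ Fin n (used for induced
-- subtrigraphs G[R], which keep θ restricted to R), with weights
-- wv, wo, wu (only their values on V matter).
-- wt_{(G[V],w)}(S) for S ⊆ V:
wtOn : ∀ {n} → Subset n → (Fin n → ℕ) → (Fin n → Fin n → ℕ) → (Fin n → Fin n → ℕ)
     → Subset n → ℕ
wtOn V wv wo wu S =
  sumIn S wv
  + sumIn S (λ u → sumIn (V ∖ S) (λ v → wo u v))
  + sumPairsIn (V ∖ S) wu

stableOn : ∀ {n} → Trigraph n → Subset n → Subset n → Bool
stableOn G V S =
  allF (λ u → not (lookup S u) ∨ lookup V u)
  ∧ allF (λ u → allF (λ v →
      not (lookup S u ∧ lookup S v ∧ not ⌊ u ≟ v ⌋ ∧ isPlus (θ G u v))))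

maxL : List ℕ → ℕ
maxL = foldr _⊔_ 0

-- α(G[V], w) = max weight of a stable set of G[V] (∅ is always stable, weights ≥ 0)
αOn : ∀ {n} → Trigraph n → Subset n → (Fin n → ℕ) → (Fin n → Fin n → ℕ)
    → (Fin n → Fin n → ℕ) → ℕ
αOn G V wv wo wu =
  maxL (map (λ S → if stableOn G V S then wtOn V wv wo wu S else 0) (allSubsets _))

-- Red[G,w;R]: vertex weights w'(u) = max{w(u) - Σ_{v∉R}(w(uv) - w(u,v)), 0}
-- (truncated subtraction ∸ gives max{·,0}; since w(u,v) ≤ w(uv) for distinct u,v,
-- each inner difference is exact).
redV : ∀ {n} {G : Trigraph n} → Weight G → Subset n → Fin n → ℕ
redV w R u = wv w u ∸ sumIn (full ∖ R) (λ v → wu w u v ∸ wo w u v)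

αRed : ∀ {n} (G : Trigraph n) → Weight G → Subset n → ℕ
αRed G w R = αOn G R (redV w R) (wo w) (wu w)

Ext : ∀ {n} {G : Trigraph n} → Weight G → Subset n → ℕ
Ext w R = sumPairsIn (full ∖ R) (wu w)
        + sumIn R (λ u → sumIn (full ∖ R) (λ v → wu w u v))

αR : ∀ {n} (G : Trigraph n) → Weight G → Subset n → ℕ
αR G w R = αRed G w R + Ext w R

Disjoint : ∀ {n} → Subset n → Subset n → Set
Disjoint R₁ R₂ = ∀ u → lookup R₁ u ≡ true → lookup R₂ u ≡ false

module Submission where

-- Write wt(S) for the weight of a set S in the whole weighted trigraph (G,w),
-- and, for S ⊆ R, wtRed R S for its weight in Red[G,w;R]; so
-- α_R = max { wtRed R S + Ext[G,w;R] : S stable in G[R] }.  The heart of the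
-- proof is the characterization
--     α_R = max { wt(S) : S stable in G, S ⊆ R },
-- which rests on two comparisons for S ⊆ R:
--   * wt(S) ≤ wtRed R S + Ext, since w(u) is at most the reduced weight w'(u)
--     plus the amount loss(u) = Σ_{v∉R}(w(uv) − w(u,v)) subtracted from it, and
--     Σ_{u∈S} loss(u) plus the edge part of wt(S) is exactly the edge part of
--     wtRed R S plus Ext (edgeWt-decomposition);
--   * wtRed R S + Ext ≤ wt(S'), where S' ⊆ S keeps the vertices whose reduced
--     weight was not truncated at 0; dropping vertices from a set never
--     decreases the edge part of its weight (edgeWt-antitone).
-- The lower bound is then monotonicity of this maximum in R, and the upper
-- bound holds because restricting a stable S ⊆ R₁ ∪ R₂ to S ∩ R₁ loses at most
-- Σ_{u∈R₂} w(u) (wt-drop).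

open import Defs
open import Data.Nat using (ℕ; zero; suc; _+_; _∸_; _≤_; _<ᵇ_; z≤n)
open import Data.Nat.Properties
  using ( +-0-commutativeMonoid; ≤-refl; ≤-reflexive; ≤-trans; ≤-antisym; module ≤-Reasoning
        ; +-assoc; +-identityʳ; +-mono-≤; +-monoˡ-≤; +-monoʳ-≤; +-cancelʳ-≤; m≤n+m
        ; m∸n+n≡m; m≤n+m∸n; m≤n⇒m∸n≡0; _≤?_; <⇒≤; ≰⇒>; ≮⇒≥; <-asym; <ᵇ-reflects-<
        ; m≤m⊔n; m≤n⊔m; ⊔-lub; +-distribʳ-⊔ )
open import Data.Nat.Tactic.RingSolver using (solve-∀)
open import Algebra.Properties.CommutativeMonoid.Sum +-0-commutativeMonoid
  using (sum; sum-cong-≗; sum-replicate-zero; ∑-distrib-+; ∑-comm)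
open import Data.Bool using (Bool; true; false; _∧_; _∨_; not; if_then_else_)
open import Data.Bool.Properties using (∧-zeroʳ; ∧-conicalˡ; ∧-conicalʳ)
open import Data.Fin using (Fin; zero; suc; toℕ; _≟_)
open import Data.Fin.Properties using (toℕ-injective)
open import Data.Vec using ([]; _∷_; lookup; tabulate)
open import Data.Vec.Properties using (lookup∘tabulate)
open import Data.List using (List; []; _∷_; map)
open import Data.List.Membership.Propositional using (_∈_)
open import Data.List.Membership.Propositional.Properties using (∈-map⁺; ∈-++⁺ˡ; ∈-++⁺ʳ)
open import Data.List.Relation.Unary.Any using (here; there)
open import Data.Product using (_×_; _,_)
open import Function using (_∘_)
open import Relation.Nullary using (yes; no; contradiction)
open import Relation.Nullary.Reflects using (ofʸ; ofⁿ)
open import Relation.Nullary.Decidable using (⌊_⌋; isYes≗does; dec-false)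
open import Relation.Binary.PropositionalEquality

variable
  n : ℕ

-- Sums over Fin n.  Defs sums by sumF; the commutative-monoid laws are taken
-- from the library sum, which agrees with it.

sumF≡sum : (f : Fin n → ℕ) → sumF f ≡ sum f
sumF≡sum {zero} f = refl
sumF≡sum {suc n} f = cong (f zero +_) (sumF≡sum (f ∘ suc))

sumF-cong : {f g : Fin n → ℕ} → f ≗ g → sumF f ≡ sumF g
sumF-cong {f = f} {g} f≗g = trans (sumF≡sum f) (trans (sum-cong-≗ f≗g) (sym (sumF≡sum g)))

sumF-mono : {f g : Fin n → ℕ} → (∀ i → f i ≤ g i) → sumF f ≤ sumF g
sumF-mono {zero} f≤g = z≤n
sumF-mono {suc n} f≤g = +-mono-≤ (f≤g zero) (sumF-mono (f≤g ∘ suc))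

sumF-+ : (f g : Fin n → ℕ) → sumF (λ i → f i + g i) ≡ sumF f + sumF g
sumF-+ f g = begin
  sumF (λ i → f i + g i)   ≡⟨ sumF≡sum (λ i → f i + g i) ⟩
  sum (λ i → f i + g i)    ≡⟨ ∑-distrib-+ f g ⟩
  sum f + sum g            ≡⟨ cong₂ _+_ (sumF≡sum f) (sumF≡sum g) ⟨
  sumF f + sumF g          ∎
  where open ≡-Reasoning

sumF-swap : (f : Fin n → Fin n → ℕ) →
  sumF (λ i → sumF (f i)) ≡ sumF (λ j → sumF (λ i → f i j))
sumF-swap f = begin
  sumF (λ i → sumF (f i))           ≡⟨ sumF≡sum² f ⟩
  sum (λ i → sum (f i))             ≡⟨ ∑-comm f ⟩
  sum (λ j → sum (λ i → f i j))     ≡⟨ sumF≡sum² (λ j i → f i j) ⟨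
  sumF (λ j → sumF (λ i → f i j))   ∎
  where
  open ≡-Reasoning
  sumF≡sum² : (g : Fin n → Fin n → ℕ) → sumF (λ i → sumF (g i)) ≡ sum (λ i → sum (g i))
  sumF≡sum² g = trans (sumF≡sum (λ i → sumF (g i))) (sum-cong-≗ (λ i → sumF≡sum (g i)))

Pred : ℕ → Set
Pred n = Fin n → Bool

variable
  p q r s s' : Pred n

⊤ᵖ ∅ᵖ : Pred n
⊤ᵖ _ = true
∅ᵖ _ = false

_∪ᵖ_ _∩ᵖ_ _─_ : Pred n → Pred n → Pred n
(p ∪ᵖ q) u = p u ∨ q u
(p ∩ᵖ q) u = p u ∧ q u
(p ─ q) u = p u ∧ not (q u)

_⊆_ : Pred n → Pred n → Set
p ⊆ q = ∀ u → p u ≡ true → q u ≡ true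

Disjointᵖ : Pred n → Pred n → Set
Disjointᵖ p q = ∀ u → p u ∧ q u ≡ false

⊆-trans : p ⊆ q → q ⊆ r → p ⊆ r
⊆-trans p⊆q q⊆r u = q⊆r u ∘ p⊆q u

∩-⊆ˡ : (p q : Pred n) → (p ∩ᵖ q) ⊆ p
∩-⊆ˡ p q u with p u
... | true = λ _ → refl

∩-⊆ʳ : (p q : Pred n) → (p ∩ᵖ q) ⊆ q
∩-⊆ʳ p q u with p u
... | true = λ qu → qu

─-congʳ : (r : Pred n) → s ≗ s' → (r ─ s) ≗ (r ─ s')
─-congʳ r s≗s' u = cong (λ b → r u ∧ not b) (s≗s' u)

⊆-split : (s r : Pred n) → s ⊆ r → r ≗ (s ∪ᵖ (r ─ s))
⊆-split s r s⊆r u with s u | r u | s⊆r u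
... | true  | true  | _     = refl
... | true  | false | s⊆r-u = contradiction (s⊆r-u refl) λ ()
... | false | true  | _     = refl
... | false | false | _     = refl

─-disjoint : (s r : Pred n) → Disjointᵖ s (r ─ s)
─-disjoint s r u with s u
... | true  = ∧-zeroʳ _
... | false = refl

diff-chain : (s' s r : Pred n) → s' ⊆ s → s ⊆ r → (r ─ s') ≗ ((s ─ s') ∪ᵖ (r ─ s))
diff-chain s' s r s'⊆s s⊆r u with s' u | s u | r u | s'⊆s u | s⊆r u
... | true  | true  | _     | _      | _     = refl
... | true  | false | _     | s'⊆s-u | _     = contradiction (s'⊆s-u refl) λ ()
... | false | true  | true  | _      | _     = refl
... | false | true  | false | _      | s⊆r-u = contradiction (s⊆r-u refl) λ ()
... | false | false | _     | _      | _     = refl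

diff-chain-disjoint : (s' s r : Pred n) → Disjointᵖ (s ─ s') (r ─ s)
diff-chain-disjoint s' s r u with s u | r u
... | true  | true  = ∧-zeroʳ _
... | true  | false = ∧-zeroʳ _
... | false | _     = refl

≗⇒⊆ : p ≗ q → p ⊆ q
≗⇒⊆ p≗q u pu = trans (sym (p≗q u)) pu

∪-⊆ˡ : (p q : Pred n) → p ⊆ (p ∪ᵖ q)
∪-⊆ˡ p q u pu rewrite pu = refl

─∩-⊆ : (s p q : Pred n) → s ⊆ (p ∪ᵖ q) → (s ─ (s ∩ᵖ p)) ⊆ q
─∩-⊆ s p q s⊆p∪q u outside-p with s u | p u | s⊆p∪q u
... | true  | false | s⊆p∪q-u = s⊆p∪q-u refl
... | true  | true  | _       = contradiction outside-p λ ()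
... | false | _     | _       = contradiction outside-p λ ()

⊆-disjoint-compl : (s r : Pred n) → s ⊆ r → Disjointᵖ s (⊤ᵖ ─ r)
⊆-disjoint-compl s r s⊆r u with s u | s⊆r u
... | true  | s⊆r-u = cong not (s⊆r-u refl)
... | false | _     = refl

disjoint⇒≢ : Disjointᵖ p q → ∀ {u v} → p u ≡ true → q v ≡ true → u ≢ v
disjoint⇒≢ disj {u} pu qv refl = contradiction (trans (sym (disj u)) (cong₂ _∧_ pu qv)) λ ()

mask : Bool → ℕ → ℕ
mask b x = if b then x else 0

mask-sumF : (b : Bool) (g : Fin n → ℕ) → mask b (sumF g) ≡ sumF (λ i → mask b (g i))
mask-sumF true  g = refl
mask-sumF {n} false g = sym (trans (sumF≡sum {n} (λ _ → 0)) (sum-replicate-zero n))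

-- Σ_{u ∈ p} f u; sumIn S f of Defs is Σ∈ (lookup S) f.
Σ∈ : Pred n → (Fin n → ℕ) → ℕ
Σ∈ p f = sumF (λ u → mask (p u) (f u))

Σ∈-cong : {f g : Fin n → ℕ} → (∀ u → p u ≡ true → f u ≡ g u) → Σ∈ p f ≡ Σ∈ p g
Σ∈-cong {p = p} {f} {g} f≡g = sumF-cong λ u → pointwise u (p u) refl
  where
  pointwise : ∀ u b → p u ≡ b → mask b (f u) ≡ mask b (g u)
  pointwise u true  pu = f≡g u pu
  pointwise u false _  = refl

Σ∈-mono : {f g : Fin n → ℕ} → (∀ u → p u ≡ true → f u ≤ g u) → Σ∈ p f ≤ Σ∈ p g
Σ∈-mono {p = p} {f} {g} f≤g = sumF-mono λ u → pointwise u (p u) refl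
  where
  pointwise : ∀ u b → p u ≡ b → mask b (f u) ≤ mask b (g u)
  pointwise u true  pu = f≤g u pu
  pointwise u false _  = z≤n

Σ∈-congˢ : {f : Fin n → ℕ} → p ≗ q → Σ∈ p f ≡ Σ∈ q f
Σ∈-congˢ {f = f} p≗q = sumF-cong λ u → cong (λ b → mask b (f u)) (p≗q u)

Σ∈-monoˢ : {f : Fin n → ℕ} → p ⊆ q → Σ∈ p f ≤ Σ∈ q f
Σ∈-monoˢ {p = p} {q} {f} p⊆q = sumF-mono λ u → pointwise (p u) (q u) (p⊆q u)
  where
  pointwise : ∀ {x} a b → (a ≡ true → b ≡ true) → mask a x ≤ mask b x
  pointwise true  b a⇒b rewrite a⇒b refl = ≤-refl
  pointwise false b _ = z≤n

Σ∈-+ : (p : Pred n) (f g : Fin n → ℕ) → Σ∈ p (λ u → f u + g u) ≡ Σ∈ p f + Σ∈ p g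
Σ∈-+ p f g = trans (sumF-cong λ u → mask-+ (p u))
                   (sumF-+ (λ u → mask (p u) (f u)) (λ u → mask (p u) (g u)))
  where
  mask-+ : ∀ {x y} b → mask b (x + y) ≡ mask b x + mask b y
  mask-+ true  = refl
  mask-+ false = refl

Σ∈-∪ : (p q : Pred n) (f : Fin n → ℕ) → Disjointᵖ p q → Σ∈ (p ∪ᵖ q) f ≡ Σ∈ p f + Σ∈ q f
Σ∈-∪ p q f disj = trans (sumF-cong λ u → mask-∨ (p u) (q u) (disj u))
                        (sumF-+ (λ u → mask (p u) (f u)) (λ u → mask (q u) (f u)))
  where
  mask-∨ : ∀ {x} a b → a ∧ b ≡ false → mask (a ∨ b) x ≡ mask a x + mask b x
  mask-∨ true  false _ = sym (+-identityʳ _)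
  mask-∨ false b     _ = refl

ΣΣ : Pred n → Pred n → (Fin n → Fin n → ℕ) → ℕ
ΣΣ p q f = Σ∈ p (λ u → Σ∈ q (f u))

ΣΣ-cong : {f g : Fin n → Fin n → ℕ} →
  (∀ u v → p u ≡ true → q v ≡ true → f u v ≡ g u v) → ΣΣ p q f ≡ ΣΣ p q g
ΣΣ-cong f≡g = Σ∈-cong λ u pu → Σ∈-cong (λ v → f≡g u v pu)

ΣΣ-mono : {f g : Fin n → Fin n → ℕ} →
  (∀ u v → p u ≡ true → q v ≡ true → f u v ≤ g u v) → ΣΣ p q f ≤ ΣΣ p q g
ΣΣ-mono f≤g = Σ∈-mono λ u pu → Σ∈-mono (λ v → f≤g u v pu)

ΣΣ-congˢ : {p' q' : Pred n} {f : Fin n → Fin n → ℕ} → p ≗ p' → q ≗ q' → ΣΣ p q f ≡ ΣΣ p' q' f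
ΣΣ-congˢ {f = f} p≗p' q≗q' = trans (Σ∈-congˢ p≗p') (Σ∈-cong λ u _ → Σ∈-congˢ {f = f u} q≗q')

ΣΣ-+ : (f g : Fin n → Fin n → ℕ) → ΣΣ p q (λ u v → f u v + g u v) ≡ ΣΣ p q f + ΣΣ p q g
ΣΣ-+ {p = p} {q} f g = trans (Σ∈-cong λ u _ → Σ∈-+ q (f u) (g u)) (Σ∈-+ p _ _)

ΣΣ-∪ˡ : (p p' q : Pred n) (f : Fin n → Fin n → ℕ) → Disjointᵖ p p' →
  ΣΣ (p ∪ᵖ p') q f ≡ ΣΣ p q f + ΣΣ p' q f
ΣΣ-∪ˡ p p' q f disj = Σ∈-∪ p p' (λ u → Σ∈ q (f u)) disj

ΣΣ-∪ʳ : (p q q' : Pred n) (f : Fin n → Fin n → ℕ) → Disjointᵖ q q' →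
  ΣΣ p (q ∪ᵖ q') f ≡ ΣΣ p q f + ΣΣ p q' f
ΣΣ-∪ʳ p q q' f disj =
  trans (Σ∈-cong λ u _ → Σ∈-∪ q q' (f u) disj) (Σ∈-+ p (λ u → Σ∈ q (f u)) (λ u → Σ∈ q' (f u)))

ΣΣ-swap : (p q : Pred n) (f : Fin n → Fin n → ℕ) → ΣΣ p q f ≡ ΣΣ q p (λ u v → f v u)
ΣΣ-swap p q f = begin
  sumF (λ u → mask (p u) (sumF (λ v → mask (q v) (f u v))))
    ≡⟨ sumF-cong (λ u → mask-sumF (p u) (λ v → mask (q v) (f u v))) ⟩
  sumF (λ u → sumF (λ v → mask (p u) (mask (q v) (f u v))))
    ≡⟨ sumF-swap (λ u v → mask (p u) (mask (q v) (f u v))) ⟩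
  sumF (λ v → sumF (λ u → mask (p u) (mask (q v) (f u v))))
    ≡⟨ sumF-cong (λ v → sumF-cong (λ u → mask-comm (p u) (q v))) ⟩
  sumF (λ v → sumF (λ u → mask (q v) (mask (p u) (f u v))))
    ≡⟨ sumF-cong (λ v → mask-sumF (q v) (λ u → mask (p u) (f u v))) ⟨
  sumF (λ v → mask (q v) (sumF (λ u → mask (p u) (f u v)))) ∎
  where
  open ≡-Reasoning
  mask-comm : ∀ {x} a b → mask a (mask b x) ≡ mask b (mask a x)
  mask-comm true  b     = refl
  mask-comm false true  = refl
  mask-comm false false = refl

-- Sum over unordered pairs {u,v} ⊆ p, each pair counted once, as (u,v) with
-- u < v; sumPairsIn S f of Defs is Σpairs (lookup S) f.
Σpairs : Pred n → (Fin n → Fin n → ℕ) → ℕ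
Σpairs p f = ΣΣ p p (λ u v → mask (toℕ u <ᵇ toℕ v) (f u v))

Σpairs-congˢ : {f : Fin n → Fin n → ℕ} → p ≗ q → Σpairs p f ≡ Σpairs q f
Σpairs-congˢ p≗q = ΣΣ-congˢ p≗q p≗q

mask-ordered : ∀ {u v : Fin n} x → u ≢ v →
  mask (toℕ u <ᵇ toℕ v) x + mask (toℕ v <ᵇ toℕ u) x ≡ x
mask-ordered {u = u} {v} x u≢v
  with toℕ u <ᵇ toℕ v | <ᵇ-reflects-< (toℕ u) (toℕ v)
     | toℕ v <ᵇ toℕ u | <ᵇ-reflects-< (toℕ v) (toℕ u)
... | true  | ofʸ u<v | true  | ofʸ v<u = contradiction v<u (<-asym u<v)
... | true  | ofʸ _   | false | ofⁿ _   = +-identityʳ x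
... | false | ofⁿ _   | true  | ofʸ _   = refl
... | false | ofⁿ u≮v | false | ofⁿ v≮u =
  contradiction (toℕ-injective (≤-antisym (≮⇒≥ v≮u) (≮⇒≥ u≮v))) u≢v

Σpairs-∪ : (p q : Pred n) (f : Fin n → Fin n → ℕ) → Disjointᵖ p q → (∀ u v → f u v ≡ f v u) →
  Σpairs (p ∪ᵖ q) f ≡ Σpairs p f + Σpairs q f + ΣΣ p q f
Σpairs-∪ {n} p q f disj f-sym = begin
    ΣΣ (p ∪ᵖ q) (p ∪ᵖ q) g
  ≡⟨ ΣΣ-∪ˡ p q (p ∪ᵖ q) g disj ⟩
    ΣΣ p (p ∪ᵖ q) g + ΣΣ q (p ∪ᵖ q) g
  ≡⟨ cong₂ _+_ (ΣΣ-∪ʳ p p q g disj) (ΣΣ-∪ʳ q p q g disj) ⟩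
    (ΣΣ p p g + ΣΣ p q g) + (ΣΣ q p g + ΣΣ q q g)
  ≡⟨ cong (λ z → (ΣΣ p p g + ΣΣ p q g) + (z + ΣΣ q q g)) (ΣΣ-swap q p g) ⟩
    (ΣΣ p p g + ΣΣ p q g) + (ΣΣ p q gᵀ + ΣΣ q q g)
  ≡⟨ regroup (ΣΣ p p g) (ΣΣ p q g) (ΣΣ p q gᵀ) (ΣΣ q q g) ⟩
    ΣΣ p p g + ΣΣ q q g + (ΣΣ p q g + ΣΣ p q gᵀ)
  ≡⟨ cong (ΣΣ p p g + ΣΣ q q g +_) (ΣΣ-+ g gᵀ) ⟨
    ΣΣ p p g + ΣΣ q q g + ΣΣ p q (λ u v → g u v + gᵀ u v)
  ≡⟨ cong (ΣΣ p p g + ΣΣ q q g +_) (ΣΣ-cong cross) ⟩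
    ΣΣ p p g + ΣΣ q q g + ΣΣ p q f ∎
  where
  open ≡-Reasoning
  g gᵀ : Fin n → Fin n → ℕ
  g u v = mask (toℕ u <ᵇ toℕ v) (f u v)
  gᵀ u v = g v u
  regroup : ∀ a b c d → (a + b) + (c + d) ≡ a + d + (b + c)
  regroup = solve-∀
  cross : ∀ u v → p u ≡ true → q v ≡ true → g u v + gᵀ u v ≡ f u v
  cross u v pu qv rewrite f-sym v u =
    mask-ordered {u = u} {v} (f u v) (disjoint⇒≢ {p = p} {q} disj pu qv)

-- Truncated subtraction: x ∸ y plus y is x when y ≤ x, and x ∸ y is 0 otherwise.
-- Pointwise form used to compare reduced and original vertex weights.
truncation-bound : ∀ b x y →
  mask b (x ∸ y) + mask (b ∧ ⌊ y ≤? x ⌋) y ≤ mask (b ∧ ⌊ y ≤? x ⌋) x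
truncation-bound false x y = z≤n
truncation-bound true  x y with y ≤? x
... | yes y≤x = ≤-reflexive (m∸n+n≡m y≤x)
... | no  y≰x = ≤-reflexive (trans (+-identityʳ (x ∸ y)) (m≤n⇒m∸n≡0 (<⇒≤ (≰⇒> y≰x))))

module Weights {G : Trigraph n} (w : Weight G) where

  edgeWt : Pred n → Pred n → ℕ
  edgeWt r s = ΣΣ s (r ─ s) (wo w) + Σpairs (r ─ s) (wu w)

  wt : Pred n → ℕ
  wt s = Σ∈ s (wv w) + edgeWt ⊤ᵖ s

  -- loss R u = Σ_{v∉R} (w(uv) − w(u,v)), the amount subtracted from w(u) in Red[G,w;R].
  loss : Pred n → Fin n → ℕ
  loss r u = Σ∈ (⊤ᵖ ─ r) (λ v → wu w u v ∸ wo w u v)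

  red : Pred n → Fin n → ℕ
  red r u = wv w u ∸ loss r u

  wtRed : Pred n → Pred n → ℕ
  wtRed r s = Σ∈ s (red r) + edgeWt r s

  ext : Pred n → ℕ
  ext r = Σpairs (⊤ᵖ ─ r) (wu w) + ΣΣ r (⊤ᵖ ─ r) (wu w)

  wo≤wu-across : (p q : Pred n) → Disjointᵖ p q →
    ∀ u v → p u ≡ true → q v ≡ true → wo w u v ≤ wu w u v
  wo≤wu-across p q disj u v pu qv = wo≤wu w u v (disjoint⇒≢ {p = p} {q} disj pu qv)

  -- For S ⊆ R, the losses of the vertices of S complete the edge part of wt(S)
  -- to the edge part of wtRed R S plus Ext: the terms w(u,v) with u ∈ S, v ∉ R
  -- become w(uv), and the remaining terms are regrouped along R ∖ S and V ∖ R.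
  edgeWt-decomposition : (r s : Pred n) → s ⊆ r →
    Σ∈ s (loss r) + edgeWt ⊤ᵖ s ≡ edgeWt r s + ext r
  edgeWt-decomposition r s s⊆r = begin
      ΣΣ s c X + (ΣΣ s (⊤ᵖ ─ s) (wo w) + Σpairs (⊤ᵖ ─ s) (wu w))
    ≡⟨ cong₂ (λ y z → ΣΣ s c X + (y + z)) outsideWo outsidePairs ⟩
      ΣΣ s c X + ((ΣΣ s a (wo w) + ΣΣ s c (wo w))
                  + (Σpairs a (wu w) + Σpairs c (wu w) + ΣΣ a c (wu w)))
    ≡⟨ regroup (ΣΣ s c X) (ΣΣ s a (wo w)) (ΣΣ s c (wo w))
               (Σpairs a (wu w)) (Σpairs c (wu w)) (ΣΣ a c (wu w)) ⟩
      ΣΣ s a (wo w) + Σpairs a (wu w)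
        + (Σpairs c (wu w) + ((ΣΣ s c X + ΣΣ s c (wo w)) + ΣΣ a c (wu w)))
    ≡⟨ cong (λ z → ΣΣ s a (wo w) + Σpairs a (wu w) + (Σpairs c (wu w) + (z + ΣΣ a c (wu w))))
            lossCompletes ⟩
      ΣΣ s a (wo w) + Σpairs a (wu w) + (Σpairs c (wu w) + (ΣΣ s c (wu w) + ΣΣ a c (wu w)))
    ≡⟨ cong (λ z → ΣΣ s a (wo w) + Σpairs a (wu w) + (Σpairs c (wu w) + z)) splitR ⟨
      ΣΣ s a (wo w) + Σpairs a (wu w) + (Σpairs c (wu w) + ΣΣ r c (wu w)) ∎
    where
    open ≡-Reasoning
    a c : Pred n
    a = r ─ s
    c = ⊤ᵖ ─ r
    -- Σ∈ s (loss r) is ΣΣ s c X by definition.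
    X : Fin n → Fin n → ℕ
    X u v = wu w u v ∸ wo w u v
    outside : (⊤ᵖ ─ s) ≗ (a ∪ᵖ c)
    outside = diff-chain s r ⊤ᵖ s⊆r (λ _ _ → refl)
    outsideWo : ΣΣ s (⊤ᵖ ─ s) (wo w) ≡ ΣΣ s a (wo w) + ΣΣ s c (wo w)
    outsideWo = trans (ΣΣ-congˢ {p = s} (λ _ → refl) outside)
                      (ΣΣ-∪ʳ s a c (wo w) (diff-chain-disjoint s r ⊤ᵖ))
    outsidePairs : Σpairs (⊤ᵖ ─ s) (wu w) ≡ Σpairs a (wu w) + Σpairs c (wu w) + ΣΣ a c (wu w)
    outsidePairs = trans (Σpairs-congˢ outside)
                         (Σpairs-∪ a c (wu w) (diff-chain-disjoint s r ⊤ᵖ) (wusym w))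
    lossCompletes : ΣΣ s c X + ΣΣ s c (wo w) ≡ ΣΣ s c (wu w)
    lossCompletes = trans (sym (ΣΣ-+ X (wo w))) (ΣΣ-cong λ u v su cv →
      m∸n+n≡m (wo≤wu-across s c (⊆-disjoint-compl s r s⊆r) u v su cv))
    splitR : ΣΣ r c (wu w) ≡ ΣΣ s c (wu w) + ΣΣ a c (wu w)
    splitR = trans (ΣΣ-congˢ {q = c} (⊆-split s r s⊆r) (λ _ → refl))
                   (ΣΣ-∪ˡ s a c (wu w) (─-disjoint s r))
    regroup : ∀ x₁ x₂ x₃ x₄ x₅ x₆ →
      x₁ + ((x₂ + x₃) + (x₄ + x₅ + x₆)) ≡ x₂ + x₄ + (x₅ + ((x₁ + x₃) + x₆))
    regroup = solve-∀

  -- Dropping vertices from S ⊆ R never decreases the edge part of its weight: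
  -- for each dropped u the terms w(u,v), v ∈ R ∖ S, are replaced by the larger
  -- w(uv), and further nonnegative terms appear.
  edgeWt-antitone : (r s s' : Pred n) → s' ⊆ s → s ⊆ r → edgeWt r s ≤ edgeWt r s'
  edgeWt-antitone r s s' s'⊆s s⊆r = begin
      ΣΣ s a (wo w) + Σpairs a (wu w)
    ≡⟨ cong (_+ Σpairs a (wu w)) splitS ⟩
      ΣΣ s' a (wo w) + ΣΣ t a (wo w) + Σpairs a (wu w)
    ≤⟨ +-monoˡ-≤ (Σpairs a (wu w))
         (+-monoʳ-≤ (ΣΣ s' a (wo w)) (ΣΣ-mono (wo≤wu-across t a (diff-chain-disjoint s' s r)))) ⟩
      ΣΣ s' a (wo w) + ΣΣ t a (wu w) + Σpairs a (wu w)
    ≤⟨ addTerms (ΣΣ s' a (wo w)) (ΣΣ t a (wu w)) (Σpairs a (wu w))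
                (ΣΣ s' t (wo w)) (Σpairs t (wu w)) ⟩
      (ΣΣ s' t (wo w) + ΣΣ s' a (wo w)) + (Σpairs t (wu w) + Σpairs a (wu w) + ΣΣ t a (wu w))
    ≡⟨ cong₂ _+_ splitWo splitPairs ⟨
      ΣΣ s' a' (wo w) + Σpairs a' (wu w) ∎
    where
    open ≤-Reasoning
    t a a' : Pred n
    t = s ─ s'
    a = r ─ s
    a' = r ─ s'
    splitS : ΣΣ s a (wo w) ≡ ΣΣ s' a (wo w) + ΣΣ t a (wo w)
    splitS = trans (ΣΣ-congˢ {q = a} (⊆-split s' s s'⊆s) (λ _ → refl))
                   (ΣΣ-∪ˡ s' t a (wo w) (─-disjoint s' s))
    outside : a' ≗ (t ∪ᵖ a)
    outside = diff-chain s' s r s'⊆s s⊆r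
    splitWo : ΣΣ s' a' (wo w) ≡ ΣΣ s' t (wo w) + ΣΣ s' a (wo w)
    splitWo = trans (ΣΣ-congˢ {p = s'} (λ _ → refl) outside)
                    (ΣΣ-∪ʳ s' t a (wo w) (diff-chain-disjoint s' s r))
    splitPairs : Σpairs a' (wu w) ≡ Σpairs t (wu w) + Σpairs a (wu w) + ΣΣ t a (wu w)
    splitPairs = trans (Σpairs-congˢ outside)
                       (Σpairs-∪ t a (wu w) (diff-chain-disjoint s' s r) (wusym w))
    addTerms : ∀ x y z x' z' → x + y + z ≤ (x' + x) + (z' + z + y)
    addTerms x y z x' z' = ≤-trans (m≤n+m (x + y + z) (x' + z')) (≤-reflexive (regroup x y z x' z'))
      where
      regroup : ∀ x y z x' z' → x' + z' + (x + y + z) ≡ (x' + x) + (z' + z + y)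
      regroup = solve-∀

  -- For S ⊆ R: wt(S) ≤ wtRed R S + Ext, since w(u) ≤ loss R u + w'(u).
  wt≤wtRed+ext : (r s : Pred n) → s ⊆ r → wt s ≤ wtRed r s + ext r
  wt≤wtRed+ext r s s⊆r = begin
      Σ∈ s (wv w) + edgeWt ⊤ᵖ s
    ≤⟨ +-monoˡ-≤ (edgeWt ⊤ᵖ s) (Σ∈-mono λ u _ → m≤n+m∸n (wv w u) (loss r u)) ⟩
      Σ∈ s (λ u → loss r u + red r u) + edgeWt ⊤ᵖ s
    ≡⟨ cong (_+ edgeWt ⊤ᵖ s) (Σ∈-+ s (loss r) (red r)) ⟩
      Σ∈ s (loss r) + Σ∈ s (red r) + edgeWt ⊤ᵖ s
    ≡⟨ regroup (Σ∈ s (loss r)) (Σ∈ s (red r)) (edgeWt ⊤ᵖ s) ⟩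
      Σ∈ s (red r) + (Σ∈ s (loss r) + edgeWt ⊤ᵖ s)
    ≡⟨ cong (Σ∈ s (red r) +_) (edgeWt-decomposition r s s⊆r) ⟩
      Σ∈ s (red r) + (edgeWt r s + ext r)
    ≡⟨ +-assoc (Σ∈ s (red r)) (edgeWt r s) (ext r) ⟨
      wtRed r s + ext r ∎
    where
    open ≤-Reasoning
    regroup : ∀ x y z → x + y + z ≡ y + (x + z)
    regroup = solve-∀

  prune : Pred n → Pred n → Pred n
  prune r s = s ∩ᵖ (λ u → ⌊ loss r u ≤? wv w u ⌋)

  prune-⊆ : (r s : Pred n) → prune r s ⊆ s
  prune-⊆ r s = ∩-⊆ˡ s _

  -- On prune R S the reduced
  -- weights are exact, the other vertices of S contribute 0 to wtRed R S,
  -- and dropping them does not decrease the edge part.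
  wtRed+ext≤wt-prune : (r s : Pred n) → s ⊆ r → wtRed r s + ext r ≤ wt (prune r s)
  wtRed+ext≤wt-prune r s s⊆r = +-cancelʳ-≤ lossP (wtRed r s + ext r) (wt sP) withLoss
    where
    open ≤-Reasoning
    sP : Pred n
    sP = prune r s
    sP⊆s : sP ⊆ s
    sP⊆s = prune-⊆ r s
    lossP : ℕ
    lossP = Σ∈ sP (loss r)
    vertices : Σ∈ s (red r) + lossP ≤ Σ∈ sP (wv w)
    vertices = ≤-trans (≤-reflexive (sym (sumF-+ (λ u → mask (s u) (red r u)) (λ u → mask (sP u) (loss r u)))))
                       (sumF-mono λ u → truncation-bound (s u) (wv w u) (loss r u))
    withLoss : wtRed r s + ext r + lossP ≤ wt sP + lossP
    withLoss = begin
        Σ∈ s (red r) + edgeWt r s + ext r + lossP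
      ≡⟨ regroup₁ (Σ∈ s (red r)) (edgeWt r s) (ext r) lossP ⟩
        Σ∈ s (red r) + lossP + edgeWt r s + ext r
      ≤⟨ +-monoˡ-≤ (ext r) (+-mono-≤ vertices (edgeWt-antitone r s sP sP⊆s s⊆r)) ⟩
        Σ∈ sP (wv w) + edgeWt r sP + ext r
      ≡⟨ +-assoc (Σ∈ sP (wv w)) (edgeWt r sP) (ext r) ⟩
        Σ∈ sP (wv w) + (edgeWt r sP + ext r)
      ≡⟨ cong (Σ∈ sP (wv w) +_) (edgeWt-decomposition r sP (⊆-trans sP⊆s s⊆r)) ⟨
        Σ∈ sP (wv w) + (lossP + edgeWt ⊤ᵖ sP)
      ≡⟨ regroup₂ (Σ∈ sP (wv w)) lossP (edgeWt ⊤ᵖ sP) ⟩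
        wt sP + lossP ∎
      where
      regroup₁ : ∀ x y z l → x + y + z + l ≡ x + l + y + z
      regroup₁ = solve-∀
      regroup₂ : ∀ x l y → x + (l + y) ≡ x + y + l
      regroup₂ = solve-∀

  wt-drop : (s s' : Pred n) → s' ⊆ s → wt s ≤ wt s' + Σ∈ (s ─ s') (wv w)
  wt-drop s s' s'⊆s = begin
      Σ∈ s (wv w) + edgeWt ⊤ᵖ s
    ≡⟨ cong (_+ edgeWt ⊤ᵖ s) splitS ⟩
      Σ∈ s' (wv w) + Σ∈ (s ─ s') (wv w) + edgeWt ⊤ᵖ s
    ≤⟨ +-monoʳ-≤ (Σ∈ s' (wv w) + Σ∈ (s ─ s') (wv w)) (edgeWt-antitone ⊤ᵖ s s' s'⊆s (λ _ _ → refl)) ⟩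
      Σ∈ s' (wv w) + Σ∈ (s ─ s') (wv w) + edgeWt ⊤ᵖ s'
    ≡⟨ regroup (Σ∈ s' (wv w)) (Σ∈ (s ─ s') (wv w)) (edgeWt ⊤ᵖ s') ⟩
      wt s' + Σ∈ (s ─ s') (wv w) ∎
    where
    open ≤-Reasoning
    splitS : Σ∈ s (wv w) ≡ Σ∈ s' (wv w) + Σ∈ (s ─ s') (wv w)
    splitS = trans (Σ∈-congˢ (⊆-split s' s s'⊆s)) (Σ∈-∪ s' (s ─ s') (wv w) (─-disjoint s' s))
    regroup : ∀ x y z → x + y + z ≡ x + z + y
    regroup = solve-∀

  wt-congˢ : s ≗ s' → wt s ≡ wt s'
  wt-congˢ s≗s' = cong₂ _+_ (Σ∈-congˢ s≗s')
    (cong₂ _+_ (ΣΣ-congˢ s≗s' (─-congʳ ⊤ᵖ s≗s')) (Σpairs-congˢ (─-congʳ ⊤ᵖ s≗s')))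

Stable : Trigraph n → Pred n → Set
Stable G s = ∀ u v → s u ≡ true → s v ≡ true → u ≢ v → isPlus (θ G u v) ≡ false

Stable-⊆ : {G : Trigraph n} (s s' : Pred n) → s' ⊆ s → Stable G s → Stable G s'
Stable-⊆ s s' s'⊆s stable u v s'u s'v = stable u v (s'⊆s u s'u) (s'⊆s v s'v)

allF-elim : (p : Fin n → Bool) → allF p ≡ true → ∀ u → p u ≡ true
allF-elim p all zero = ∧-conicalˡ _ _ all
allF-elim p all (suc u) = allF-elim (p ∘ suc) (∧-conicalʳ _ _ all) u

allF-intro : (p : Fin n → Bool) → (∀ u → p u ≡ true) → allF p ≡ true
allF-intro {zero} p _ = refl
allF-intro {suc n} p all = cong₂ _∧_ (all zero) (allF-intro (p ∘ suc) (all ∘ suc))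

stableOn-sound : (G : Trigraph n) (V S : Subset n) → stableOn G V S ≡ true →
  lookup S ⊆ lookup V × Stable G (lookup S)
stableOn-sound G V S isStable = inside , stable
  where
  inside : lookup S ⊆ lookup V
  inside u Su with lookup S u | allF-elim _ (∧-conicalˡ _ _ isStable) u
  ... | true | Vu = Vu
  noEdge : ∀ a b d e → not (a ∧ b ∧ not d ∧ e) ≡ true →
    a ≡ true → b ≡ true → d ≡ false → e ≡ false
  noEdge true true false false _ _ _ _ = refl
  stable : Stable G (lookup S)
  stable u v Su Sv u≢v =
    noEdge _ _ _ _ (allF-elim _ (allF-elim _ (∧-conicalʳ _ _ isStable) u) v) Su Sv
           (trans (isYes≗does (u ≟ v)) (dec-false (u ≟ v) u≢v))

stableOn-complete : (G : Trigraph n) (V S : Subset n) →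
  lookup S ⊆ lookup V → Stable G (lookup S) → stableOn G V S ≡ true
stableOn-complete G V S inside stable =
  cong₂ _∧_ (allF-intro _ insideClause) (allF-intro _ λ u → allF-intro _ (edgeClause u))
  where
  insideClause : ∀ u → not (lookup S u) ∨ lookup V u ≡ true
  insideClause u with lookup S u | inside u
  ... | true  | Vu = Vu refl
  ... | false | _  = refl
  edgeClause : ∀ u v → not (lookup S u ∧ lookup S v ∧ not ⌊ u ≟ v ⌋ ∧ isPlus (θ G u v)) ≡ true
  edgeClause u v with lookup S u in Su | lookup S v in Sv | u ≟ v
  ... | false | _     | _       = refl
  ... | true  | false | _       = refl
  ... | true  | true  | yes _   = refl
  ... | true  | true  | no u≢v rewrite stable u v Su Sv u≢v = refl

lookup-∖ : (A B : Subset n) → lookup (A ∖ B) ≗ (lookup A ─ lookup B)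
lookup-∖ (a ∷ A) (b ∷ B) zero = refl
lookup-∖ (a ∷ A) (b ∷ B) (suc u) = lookup-∖ A B u

lookup-∪ : (A B : Subset n) → lookup (A ∪ B) ≗ (lookup A ∪ᵖ lookup B)
lookup-∪ (a ∷ A) (b ∷ B) zero = refl
lookup-∪ (a ∷ A) (b ∷ B) (suc u) = lookup-∪ A B u

lookup-compl : (A : Subset n) → lookup (full ∖ A) ≗ (⊤ᵖ ─ lookup A)
lookup-compl (a ∷ A) zero = refl
lookup-compl (a ∷ A) (suc u) = lookup-compl A u

∈⇒≤maxL : ∀ {x xs} → x ∈ xs → x ≤ maxL xs
∈⇒≤maxL (here refl) = m≤m⊔n _ _
∈⇒≤maxL {xs = y ∷ _} (there x∈xs) = ≤-trans (∈⇒≤maxL x∈xs) (m≤n⊔m y _)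

maxL-map+≤ : {A : Set} (F : A → ℕ) (xs : List A) {e X : ℕ} →
  (∀ x → F x + e ≤ X) → e ≤ X → maxL (map F xs) + e ≤ X
maxL-map+≤ F []       bound e≤X = e≤X
maxL-map+≤ F (x ∷ xs) {e} bound e≤X =
  ≤-trans (≤-reflexive (+-distribʳ-⊔ e (F x) (maxL (map F xs))))
          (⊔-lub (bound x) (maxL-map+≤ F xs bound e≤X))

∈-allSubsets : (S : Subset n) → S ∈ allSubsets n
∈-allSubsets [] = here refl
∈-allSubsets {suc n} (true ∷ S) = ∈-++⁺ˡ (∈-map⁺ (true ∷_) (∈-allSubsets S))
∈-allSubsets {suc n} (false ∷ S) =
  ∈-++⁺ʳ (map (true ∷_) (allSubsets n)) (∈-map⁺ (false ∷_) (∈-allSubsets S))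

module Characterization {G : Trigraph n} (w : Weight G) where
  open Weights w

  wtOn≡wtRed : (R S : Subset n) → wtOn R (redV w R) (wo w) (wu w) S ≡ wtRed (lookup R) (lookup S)
  wtOn≡wtRed R S =
    trans (+-assoc (Σ∈ inS (redV w R)) (ΣΣ inS (lookup (R ∖ S)) (wo w)) (Σpairs (lookup (R ∖ S)) (wu w)))
          (cong₂ _+_ sameReduced (cong₂ _+_ (ΣΣ-congˢ {p = inS} (λ _ → refl) rest) (Σpairs-congˢ rest)))
    where
    inS : Pred n
    inS = lookup S
    rest : lookup (R ∖ S) ≗ (lookup R ─ inS)
    rest = lookup-∖ R S
    sameReduced : Σ∈ inS (redV w R) ≡ Σ∈ inS (red (lookup R))
    sameReduced = Σ∈-cong λ u _ → cong (wv w u ∸_) (Σ∈-congˢ (lookup-compl R))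

  Ext≡ext : (R : Subset n) → Ext w R ≡ ext (lookup R)
  Ext≡ext R = cong₂ _+_ (Σpairs-congˢ (lookup-compl R))
                        (ΣΣ-congˢ {p = lookup R} (λ _ → refl) (lookup-compl R))

  candidate : Subset n → Subset n → ℕ
  candidate R S = if stableOn G R S then wtOn R (redV w R) (wo w) (wu w) S else 0

  wtOn≤αRed : (R S : Subset n) → stableOn G R S ≡ true →
    wtOn R (redV w R) (wo w) (wu w) S ≤ αRed G w R
  wtOn≤αRed R S isStable =
    ≤-trans (≤-reflexive (cong (λ b → if b then wtOn R (redV w R) (wo w) (wu w) S else 0) (sym isStable)))
            (∈⇒≤maxL (∈-map⁺ (candidate R) (∈-allSubsets S)))

  α≤ : (R : Subset n) (X : ℕ) → (∀ s → Stable G s → s ⊆ lookup R → wt s ≤ X) → αR G w R ≤ X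
  α≤ R X bound = maxL-map+≤ (candidate R) (allSubsets n) perSubset ext≤X
    where
    open ≤-Reasoning
    inR : Pred n
    inR = lookup R
    -- a stable S ⊆ R is dominated by its pruned subset
    viaPrune : ∀ s → Stable G s → s ⊆ inR → wtRed inR s + ext inR ≤ X
    viaPrune s stable s⊆inR = ≤-trans (wtRed+ext≤wt-prune inR s s⊆inR)
      (bound (prune inR s) (Stable-⊆ {G = G} s (prune inR s) (prune-⊆ inR s) stable)
                           (⊆-trans (prune-⊆ inR s) s⊆inR))
    -- Ext alone is the value of the empty set
    ext≤X : Ext w R ≤ X
    ext≤X = begin
      Ext w R                 ≡⟨ Ext≡ext R ⟩
      ext inR                 ≤⟨ m≤n+m (ext inR) (wtRed inR ∅ᵖ) ⟩
      wtRed inR ∅ᵖ + ext inR  ≤⟨ viaPrune ∅ᵖ (λ _ _ ()) (λ _ ()) ⟩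
      X                       ∎
    perSubset : ∀ S → candidate R S + Ext w R ≤ X
    perSubset S with stableOn G R S in isStable
    ... | false = ext≤X
    ... | true with stableOn-sound G R S isStable
    ...   | S⊆R , stable = begin
      wtOn R (redV w R) (wo w) (wu w) S + Ext w R  ≡⟨ cong₂ _+_ (wtOn≡wtRed R S) (Ext≡ext R) ⟩
      wtRed inR (lookup S) + ext inR               ≤⟨ viaPrune (lookup S) stable S⊆R ⟩
      X                                            ∎

  wt≤α : (R : Subset n) (s : Pred n) → Stable G s → s ⊆ lookup R → wt s ≤ αR G w R
  wt≤α R s stable s⊆R = begin
      wt s                                         ≡⟨ wt-congˢ (λ u → sym (lookup∘tabulate s u)) ⟩
      wt (lookup S)                                ≤⟨ wt≤wtRed+ext (lookup R) (lookup S) S⊆R ⟩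
      wtRed (lookup R) (lookup S) + ext (lookup R) ≡⟨ cong₂ _+_ (wtOn≡wtRed R S) (Ext≡ext R) ⟨
      wtOn R (redV w R) (wo w) (wu w) S + Ext w R  ≤⟨ +-monoˡ-≤ (Ext w R) (wtOn≤αRed R S isStable) ⟩
      αR G w R                                     ∎
    where
    open ≤-Reasoning
    S : Subset n
    S = tabulate s
    S⊆s : lookup S ⊆ s
    S⊆s = ≗⇒⊆ (lookup∘tabulate s)
    S⊆R : lookup S ⊆ lookup R
    S⊆R = ⊆-trans S⊆s s⊆R
    isStable : stableOn G R S ≡ true
    isStable = stableOn-complete G R S S⊆R (Stable-⊆ {G = G} s (lookup S) S⊆s stable)

proposition3p8 : ∀ {n} (G : Trigraph n) (w : Weight G) (R₁ R₂ : Subset n)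
    → Disjoint R₁ R₂
    → (αR G w R₁ ≤ αR G w (R₁ ∪ R₂))
      × (αR G w (R₁ ∪ R₂) ≤ αR G w R₁ + sumIn R₂ (wv w))
-- (The argument does not need R₁ and R₂ to be disjoint.)
proposition3p8 {n} G w R₁ R₂ _ = lower , upper
  where
  open Weights w
  open Characterization w
  open ≤-Reasoning
  r₁ r₂ : Pred n
  r₁ = lookup R₁
  r₂ = lookup R₂
  lower : αR G w R₁ ≤ αR G w (R₁ ∪ R₂)
  lower = α≤ R₁ _ λ s stable s⊆R₁ →
    wt≤α (R₁ ∪ R₂) s stable (⊆-trans s⊆R₁ (⊆-trans (∪-⊆ˡ r₁ r₂) (≗⇒⊆ (sym ∘ lookup-∪ R₁ R₂))))
  upper : αR G w (R₁ ∪ R₂) ≤ αR G w R₁ + sumIn R₂ (wv w)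
  upper = α≤ (R₁ ∪ R₂) _ λ s stable s⊆R → begin
    wt s                                       ≤⟨ wt-drop s (s ∩ᵖ r₁) (∩-⊆ˡ s r₁) ⟩
    wt (s ∩ᵖ r₁) + Σ∈ (s ─ (s ∩ᵖ r₁)) (wv w)
      ≤⟨ +-mono-≤ (wt≤α R₁ (s ∩ᵖ r₁) (Stable-⊆ {G = G} s (s ∩ᵖ r₁) (∩-⊆ˡ s r₁) stable) (∩-⊆ʳ s r₁))
                  (Σ∈-monoˢ (─∩-⊆ s r₁ r₂ (⊆-trans s⊆R (≗⇒⊆ (lookup-∪ R₁ R₂))))) ⟩
    αR G w R₁ + sumIn R₂ (wv w)                ∎
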